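{- Let \[\gamma = \frac{1}{2}+\frac{\log_{65}7}{3}+\frac{\log_{65}17}{6} = 0.7685\dots.\] For every $\varepsilon>0$ there is a constant $c_\varepsilon>0$ such that for every positive integer $N$ there exists a set $A\subseteq[N]$ containing no non-trivial configuration of the form $\{x,x+y,x+y^2\}$ and satisfying $|A|\geq c_\varepsilon N^{\gamma-\varepsilon}$.
   Context: $[N]=\{1,2,\dots,N\}$. A configuration $\{x,x+y,x+y^2\}$ in $A$ means integers $x,y$ with $x$, $x+y$, $x+y^2$ all in $A$; it is non-trivial if $y\in\mathbb{Z}\setminus\{0\}$. -}

module Defs where

open import Data.Nat as ℕ using (ℕ; suc)
open import Data.Integer as ℤ using (ℤ; +_; _+_; _*_; _≤_)
open import Data.List using (List)
open import Data.List.Membership.Propositional using (_∈_)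
open import Data.List.Relation.Unary.All using (All)
open import Data.List.Relation.Unary.Unique.Propositional using (Unique)
open import Data.Product using (_×_)
open import Data.Empty using (⊥)
open import Relation.Binary.PropositionalEquality using (_≡_)
open import Relation.Nullary using (¬_)

-- A finite set of integers is represented by a duplicate-free list;
-- its cardinality |A| is the length of the list.

SubsetOfRange : ℕ → List ℤ → Set
SubsetOfRange N A = Unique A × All (λ a → (+ 1 ≤ a) × (a ≤ + N)) A

NoNontrivialConfig : List ℤ → Set
NoNontrivialConfig A =
  (x y : ℤ) → ¬ (y ≡ + 0) → x ∈ A → (x + y) ∈ A → (x + y * y) ∈ A → ⊥

-- γ = 1/2 + log₆₅7/3 + log₆₅17/6 = (3 + log₆₅ 833)/6, since 7²·17 = 833.
-- For naturals a, b with b ≥ 1:  a/b < γ  ⟺  65^(6a) < 833^b · 65^(3b).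
RatBelowGamma : ℕ → ℕ → Set
RatBelowGamma a b = 65 ℕ.^ (6 ℕ.* a) ℕ.< 833 ℕ.^ b ℕ.* 65 ℕ.^ (3 ℕ.* b)

-- Let A consist of the n < 65^K whose base-65 digit at position i lies in a set D(i) chosen by the
-- 2-adic valuation v of i: all 65 digits for v = 0, then alternately a 7-element and a 17-element
-- set for v = 1, 2, 3, …, and {0} at multiples of the period 2^M. If x, x + y and x + y² lie in A
-- and y = ±u·65^a with 65 ∤ u, comparing digits at position a shows that u is a difference of two
-- elements of D(a) mod 65, and at position 2a that u² is a difference of two elements of D(2a).
-- As 2a has valuation one more than a, (D(a), D(2a)) is one of finitely many pairs, and a finite
-- computation shows that no residue u ≢ 0 passes both tests for any of them.
-- Positions admitting 65, 7 and 17 digits make up ½, ⅓ and ⅙ of each period, so A has about N^γ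
-- elements below N with γ = ½ + ⅓·log₆₅ 7 + ⅙·log₆₅ 17.
module Submission where

open import Defs
open import Data.Nat
  using (ℕ; zero; suc; _+_; _*_; _^_; _/_; _%_; _≤_; _<_; _≟_; z≤n; s≤s; z<s; NonZero; ≢-nonZero;
         ⌊_/2⌋; parity)
open import Data.Nat.Properties
open import Data.Nat.DivMod
open import Data.Nat.Divisibility using (_∤_; _∣?_; divides; n∣m*n; m%n≡0⇒n∣m)
open import Data.Nat.Induction using (<-wellFounded)
open import Algebra.Properties.CommutativeSemigroup *-commutativeSemigroup using (interchange)
open import Data.Nat.Tactic.RingSolver using (solve-∀)
open import Data.Nat.Solver using (module +-*-Solver)
open +-*-Solver using (solve; _:=_; _:*_; _:^_; con)
open import Data.Parity.Base using (Parity; 0ℙ; 1ℙ)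
open import Data.Integer as ℤ using (ℤ)
import Data.Integer.Properties as ℤ
import Data.Integer.Tactic.RingSolver as ℤ
open import Data.Fin as Fin using (Fin; toℕ; #_)
open import Data.Fin.Properties using (toℕ-injective; toℕ<n; toℕ-fromℕ<; all?)
import Data.Fin.Properties as Fin
open import Data.List using (List; []; _∷_; _++_; length; map; cartesianProductWith; allFin)
open import Data.List.Properties using (length-map; length-++)
open import Data.List.Membership.Propositional using (_∈_; lose)
open import Data.List.Membership.Propositional.Properties using (∈-map⁻; ∈-cartesianProductWith⁻)
open import Data.List.Relation.Unary.Any as Any using (Any; here; any?)
open import Data.List.Relation.Unary.All as All using (All)
import Data.List.Relation.Unary.All.Properties as All
open import Data.List.Relation.Unary.AllPairs using (AllPairs)
open import Data.List.Relation.Unary.Unique.Propositional using (Unique)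
import Data.List.Relation.Unary.Unique.Propositional.Properties as Unique
open import Data.List.Relation.Unary.Unique.DecPropositional using (unique?)
open import Data.Product using (Σ; ∃₂; _×_; _,_)
open import Data.Sum using (_⊎_; inj₁; inj₂)
open import Data.Empty using (⊥)
open import Function using (_∘_)
open import Induction.WellFounded using (Acc; acc)
open import Relation.Nullary using (Dec; yes; no; ¬?; contradiction)
open import Relation.Nullary.Decidable using (_→-dec_; from-yes)
open import Relation.Binary.PropositionalEquality

∏< : ℕ → (ℕ → ℕ) → ℕ
∏< zero    f = 1
∏< (suc n) f = f 0 * ∏< n (f ∘ suc)

syntax ∏< n (λ i → e) = ∏[ i < n ] e

∏-cong : ∀ n {f g} → (∀ i → f i ≡ g i) → ∏< n f ≡ ∏< n g
∏-cong zero    f≗g = refl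
∏-cong (suc n) f≗g = cong₂ _*_ (f≗g 0) (∏-cong n (f≗g ∘ suc))

∏-+ : ∀ m n f → ∏< (m + n) f ≡ ∏< m f * ∏[ i < n ] f (m + i)
∏-+ zero    n f = sym (+-identityʳ _)
∏-+ (suc m) n f = trans (cong (f 0 *_) (∏-+ m n (f ∘ suc))) (sym (*-assoc (f 0) _ _))

∏-periodic : ∀ p k f → (∀ i → f (p + i) ≡ f i) → ∏< (k * p) f ≡ ∏< p f ^ k
∏-periodic p zero    f periodic = refl
∏-periodic p (suc k) f periodic = begin
  ∏< (p + k * p) f                     ≡⟨ ∏-+ p (k * p) f ⟩
  ∏< p f * ∏[ i < k * p ] f (p + i)    ≡⟨ cong (∏< p f *_) (∏-cong (k * p) periodic) ⟩
  ∏< p f * ∏< (k * p) f                ≡⟨ cong (∏< p f *_) (∏-periodic p k f periodic) ⟩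
  ∏< p f * ∏< p f ^ k                  ∎
  where open ≡-Reasoning

∏-* : ∀ n f g → ∏[ i < n ] (f i * g i) ≡ ∏< n f * ∏< n g
∏-* zero    f g = refl
∏-* (suc n) f g = trans (cong (f 0 * g 0 *_) (∏-* n (f ∘ suc) (g ∘ suc))) (interchange (f 0) (g 0) _ _)

∏-const : ∀ n x → ∏[ i < n ] x ≡ x ^ n
∏-const zero    x = refl
∏-const (suc n) x = cong (x *_) (∏-const n x)

∏-interleave : ∀ n f → ∏< (n + n) f ≡ ∏[ i < n ] (f (i + i) * f (suc (i + i)))
∏-interleave zero    f = refl
∏-interleave (suc n) f = begin
  f 0 * ∏< (n + suc n) (f ∘ suc)                        ≡⟨ cong (λ m → f 0 * ∏< m (f ∘ suc)) (+-suc n n) ⟩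
  f 0 * (f 1 * ∏< (n + n) (f ∘ suc ∘ suc))              ≡⟨ *-assoc (f 0) (f 1) _ ⟨
  f 0 * f 1 * ∏< (n + n) (f ∘ suc ∘ suc)                ≡⟨ cong (f 0 * f 1 *_) (∏-interleave n (f ∘ suc ∘ suc)) ⟩
  f 0 * f 1 * ∏[ i < n ] (f (2 + (i + i)) * f (3 + (i + i)))
    ≡⟨ cong (f 0 * f 1 *_) (∏-cong n (λ i → cong₂ (λ j k → f j * f k)
         (cong suc (+-suc i i)) (cong (suc ∘ suc) (+-suc i i)))) ⟨
  f 0 * f 1 * ∏[ i < n ] (f (suc i + suc i) * f (suc (suc i + suc i))) ∎
  where open ≡-Reasoning

^-distrib-* : ∀ x y n → (x * y) ^ n ≡ x ^ n * y ^ n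
^-distrib-* x y zero    = refl
^-distrib-* x y (suc n) = trans (cong (x * y *_) (^-distrib-* x y n)) (interchange x y (x ^ n) (y ^ n))

^-comm : ∀ x m n → (x ^ m) ^ n ≡ (x ^ n) ^ m
^-comm x m n = trans (^-*-assoc x m n) (trans (cong (x ^_) (*-comm m n)) (sym (^-*-assoc x n m)))

^-cancelʳ-≤ : ∀ {x y} n .{{_ : NonZero n}} → x ^ n ≤ y ^ n → x ≤ y
^-cancelʳ-≤ {x} {y} n xⁿ≤yⁿ with x ≤? y
... | yes x≤y = x≤y
... | no  x≰y = contradiction xⁿ≤yⁿ (<⇒≱ (^-monoˡ-< n (≰⇒> x≰y)))

n<2^n : ∀ n → n < 2 ^ n
n<2^n zero    = z<s
n<2^n (suc n) = begin-strict
  suc n          ≡⟨ +-comm 1 n ⟩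
  n + 1          <⟨ +-mono-<-≤ (n<2^n n) (m^n>0 2 n) ⟩
  2 ^ n + 2 ^ n  ≡⟨ cong (2 ^ n +_) (+-identityʳ (2 ^ n)) ⟨
  2 ^ suc n      ∎
  where open ≤-Reasoning

bernoulli : ∀ x n → x ^ n * (x + n) ≤ x * suc x ^ n
bernoulli x zero    = ≤-reflexive (base x)
  where
  base : ∀ x → 1 * (x + 0) ≡ x * 1
  base = solve-∀
bernoulli x (suc n) = begin
  x * t * (x + suc n)            ≡⟨ split x t n ⟩
  x * t * (x + n) + t * x        ≤⟨ +-monoʳ-≤ (x * t * (x + n)) (*-monoʳ-≤ t (m≤m+n x n)) ⟩
  x * t * (x + n) + t * (x + n)  ≡⟨ merge x t (x + n) ⟩
  suc x * (t * (x + n))          ≤⟨ *-monoʳ-≤ (suc x) (bernoulli x n) ⟩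
  suc x * (x * suc x ^ n)        ≡⟨ swap (suc x) x (suc x ^ n) ⟩
  x * (suc x * suc x ^ n)        ∎
  where
  open ≤-Reasoning
  t = x ^ n
  split : ∀ x t n → x * t * (x + suc n) ≡ x * t * (x + n) + t * x
  split = solve-∀
  merge : ∀ x t s → x * t * s + t * s ≡ suc x * (t * s)
  merge = solve-∀
  swap : ∀ a b c → a * (b * c) ≡ b * (a * c)
  swap = solve-∀

x^P*c≤y^P : ∀ {x y} c P .{{_ : NonZero x}} → x < y → x * c ≤ P → x ^ P * c ≤ y ^ P
x^P*c≤y^P {x} {y} c P x<y xc≤P = *-cancelˡ-≤ x (begin
  x * (x ^ P * c)   ≡⟨ rotate x (x ^ P) c ⟩
  x ^ P * (x * c)   ≤⟨ *-monoʳ-≤ (x ^ P) (≤-trans xc≤P (m≤n+m P x)) ⟩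
  x ^ P * (x + P)   ≤⟨ bernoulli x P ⟩
  x * suc x ^ P     ≤⟨ *-monoʳ-≤ x (^-monoˡ-≤ P x<y) ⟩
  x * y ^ P         ∎)
  where
  open ≤-Reasoning
  rotate : ∀ a b c → a * (b * c) ≡ b * (a * c)
  rotate = solve-∀

between-powers : ∀ {B} → 1 < B → ∀ n → Σ ℕ λ k → B ^ k ≤ suc n × suc n < B ^ suc k
between-powers {B} 1<B zero = 0 , ≤-refl , subst (1 <_) (sym (*-identityʳ B)) 1<B
between-powers {B} 1<B (suc n) with between-powers 1<B n
... | k , lo , hi with m≤n⇒m<n∨m≡n hi
...   | inj₁ 2+n<Bᵏ⁺¹ = k , m≤n⇒m≤1+n lo , 2+n<Bᵏ⁺¹
...   | inj₂ 2+n≡Bᵏ⁺¹ = suc k , ≤-reflexive (sym 2+n≡Bᵏ⁺¹) ,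
                        subst (_< B ^ suc (suc k)) (sym 2+n≡Bᵏ⁺¹) (^-monoʳ-< B 1<B (n<1+n (suc k)))

growth-bound : ∀ {x y n a b} k → x ^ a ≤ y ^ suc b → n ≤ x ^ suc k →
               n ^ a ≤ suc (x ^ a) ^ suc b * (y ^ k) ^ suc b
growth-bound {x} {y} {n} {a} {b} k xᵃ≤yᴮ n≤xᵏ⁺¹ = begin
  n ^ a                          ≤⟨ ^-monoˡ-≤ a n≤xᵏ⁺¹ ⟩
  (x * x ^ k) ^ a                ≡⟨ ^-distrib-* x (x ^ k) a ⟩
  x ^ a * (x ^ k) ^ a            ≡⟨ cong (x ^ a *_) (^-comm x k a) ⟩
  x ^ a * (x ^ a) ^ k            ≤⟨ *-monoʳ-≤ (x ^ a) (^-monoˡ-≤ k xᵃ≤yᴮ) ⟩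
  x ^ a * (y ^ suc b) ^ k        ≡⟨ cong (x ^ a *_) (^-comm y (suc b) k) ⟩
  x ^ a * (y ^ k) ^ suc b        ≤⟨ *-monoˡ-≤ ((y ^ k) ^ suc b) (≤-trans (n≤1+n _) (m≤m*n (suc (x ^ a)) _ {{m^n≢0 _ b}})) ⟩
  suc (x ^ a) ^ suc b * (y ^ k) ^ suc b ∎
  where open ≤-Reasoning

factor-power : ∀ {b} .{{_ : NonZero b}} → 1 < b → ∀ {n} → n ≢ 0 →
               Σ ℕ λ a → Σ ℕ λ u → n ≡ u * b ^ a × b ∤ u
factor-power {b} 1<b {n} n≢0 = go n (<-wellFounded n) n≢0
  where
  go : ∀ n → Acc _<_ n → n ≢ 0 → Σ ℕ λ a → Σ ℕ λ u → n ≡ u * b ^ a × b ∤ u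
  go n (acc rec) n≢0 with b ∣? n
  ... | no  b∤n = 0 , n , sym (*-identityʳ n) , b∤n
  ... | yes (divides q refl) with go q (rec (m<m*n q b {{≢-nonZero (n≢0 ∘ cong (_* b))}} 1<b)) (n≢0 ∘ cong (_* b))
  ...   | a , u , refl , b∤u = suc a , u , trans (*-assoc u (b ^ a) b) (cong (u *_) (*-comm (b ^ a) b)) , b∤u

length-cartesianProductWith : ∀ {A B C : Set} (f : A → B → C) xs ys →
                              length (cartesianProductWith f xs ys) ≡ length xs * length ys
length-cartesianProductWith f []       ys = refl
length-cartesianProductWith f (x ∷ xs) ys = begin
  length (map (f x) ys ++ cartesianProductWith f xs ys)         ≡⟨ length-++ (map (f x) ys) ⟩
  length (map (f x) ys) + length (cartesianProductWith f xs ys) ≡⟨ cong₂ _+_ (length-map (f x) ys) (length-cartesianProductWith f xs ys) ⟩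
  length ys + length xs * length ys                             ∎
  where open ≡-Reasoning

module _ {d : ℕ} .{{_ : NonZero d}} where

  toℕ-mod : ∀ m → toℕ (m mod d) ≡ m % d
  toℕ-mod m = toℕ-fromℕ< (m%n<n m d)

  mod-cong : ∀ {m n} → m % d ≡ n % d → m mod d ≡ n mod d
  mod-cong {m} {n} eq = toℕ-injective (trans (toℕ-mod m) (trans eq (sym (toℕ-mod n))))

  +-%-cong : ∀ {m m′ n n′} → m % d ≡ m′ % d → n % d ≡ n′ % d → (m + n) % d ≡ (m′ + n′) % d
  +-%-cong {m} {m′} {n} {n′} eqₘ eqₙ = begin
    (m + n) % d             ≡⟨ %-distribˡ-+ m n d ⟩
    (m % d + n % d) % d     ≡⟨ cong₂ (λ i j → (i + j) % d) eqₘ eqₙ ⟩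
    (m′ % d + n′ % d) % d   ≡⟨ %-distribˡ-+ m′ n′ d ⟨
    (m′ + n′) % d           ∎
    where open ≡-Reasoning

  *-%-cong : ∀ {m m′ n n′} → m % d ≡ m′ % d → n % d ≡ n′ % d → (m * n) % d ≡ (m′ * n′) % d
  *-%-cong {m} {m′} {n} {n′} eqₘ eqₙ = begin
    (m * n) % d             ≡⟨ %-distribˡ-* m n d ⟩
    (m % d * (n % d)) % d   ≡⟨ cong₂ (λ i j → (i * j) % d) eqₘ eqₙ ⟩
    (m′ % d * (n′ % d)) % d ≡⟨ %-distribˡ-* m′ n′ d ⟨
    (m′ * n′) % d           ∎
    where open ≡-Reasoning

-- NoNontrivialConfig over ℕ: δ stands for |y|, and y may have either sign.
ConfigFree : List ℕ → Set
ConfigFree S = ∀ {x y z δ} → δ ≢ 0 → x ∈ S → y ∈ S → z ∈ S →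
               x + δ ≡ y ⊎ y + δ ≡ x → x + δ * δ ≡ z → ⊥

module Digits (b : ℕ) {{_ : NonZero b}} where

  module _ (a : ℕ) where
    private instance
      b^a≢0 : NonZero (b ^ a)
      b^a≢0 = m^n≢0 b a

    digit : ℕ → Fin b
    digit n = (n / b ^ a) mod b

    digit-shift : ∀ n u → digit (n + u * b ^ a) ≡ (toℕ (digit n) + u) mod b
    digit-shift n u = mod-cong (begin
      ((n + u * b ^ a) / b ^ a) % b        ≡⟨ cong (_% b) (+-distrib-/-∣ʳ n (n∣m*n u)) ⟩
      (n / b ^ a + u * b ^ a / b ^ a) % b  ≡⟨ cong (λ v → (n / b ^ a + v) % b) (m*n/n≡m u (b ^ a)) ⟩
      (n / b ^ a + u) % b                  ≡⟨ +-%-cong (sym (trans (cong (_% b) (toℕ-mod _)) (m%n%n≡m%n _ b))) refl ⟩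
      (toℕ (digit n) + u) % b              ∎)
      where open ≡-Reasoning

    digit-zero : digit 0 ≡ 0 mod b
    digit-zero = cong (_mod b) (0/n≡0 (b ^ a))

  [d+n*b]/b≡n : ∀ (d : Fin b) n → (toℕ d + n * b) / b ≡ n
  [d+n*b]/b≡n d n = begin
    (toℕ d + n * b) / b      ≡⟨ +-distrib-/-∣ʳ (toℕ d) (n∣m*n n) ⟩
    toℕ d / b + n * b / b    ≡⟨ cong₂ _+_ (m<n⇒m/n≡0 (toℕ<n d)) (m*n/n≡m n b) ⟩
    n                        ∎
    where open ≡-Reasoning

  digit-head : ∀ d n → digit 0 (toℕ d + n * b) ≡ d
  digit-head d n = toℕ-injective (begin
    toℕ (digit 0 (toℕ d + n * b))  ≡⟨ toℕ-mod _ ⟩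
    (toℕ d + n * b) / 1 % b        ≡⟨ cong (_% b) (n/1≡n _) ⟩
    (toℕ d + n * b) % b            ≡⟨ [m+kn]%n≡m%n (toℕ d) n b ⟩
    toℕ d % b                      ≡⟨ m<n⇒m%n≡m (toℕ<n d) ⟩
    toℕ d                          ∎)
    where open ≡-Reasoning

  digit-tail : ∀ a d n → digit (suc a) (toℕ d + n * b) ≡ digit a n
  digit-tail a d n = cong (_mod b) (begin
    (toℕ d + n * b) / (b * b ^ a)   ≡⟨ m/n/o≡m/[n*o] _ b (b ^ a) ⟨
    (toℕ d + n * b) / b / b ^ a     ≡⟨ cong (_/ b ^ a) ([d+n*b]/b≡n d n) ⟩
    n / b ^ a                       ∎)
    where
    open ≡-Reasoning
    instance
      b^a≢0 : NonZero (b ^ a)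
      b^a≢0 = m^n≢0 b a
      b^1+a≢0 : NonZero (b ^ suc a)
      b^1+a≢0 = m^n≢0 b (suc a)

  digit-cons-injective : ∀ {d d′ n n′} → toℕ d + n * b ≡ toℕ d′ + n′ * b → d ≡ d′ × n ≡ n′
  digit-cons-injective {d} {d′} {n} {n′} eq =
    trans (sym (digit-head d n)) (trans (cong (digit 0) eq) (digit-head d′ n′)) ,
    trans (sym ([d+n*b]/b≡n d n)) (trans (cong (_/ b) eq) ([d+n*b]/b≡n d′ n′))

  withDigits : (ℕ → List (Fin b)) → ℕ → List ℕ
  withDigits D zero    = 0 ∷ []
  withDigits D (suc K) = cartesianProductWith (λ d n → toℕ d + n * b) (D 0) (withDigits (D ∘ suc) K)

  withDigits-digit : ∀ {D} → (∀ i → 0 mod b ∈ D i) → ∀ K {n} → n ∈ withDigits D K → ∀ a → digit a n ∈ D a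
  withDigits-digit {D} 0∈D zero    (here refl) a = subst (_∈ D a) (sym (digit-zero a)) (0∈D a)
  withDigits-digit {D} 0∈D (suc K) n∈          a =
    cons-digit a (∈-cartesianProductWith⁻ _ (D 0) (withDigits (D ∘ suc) K) n∈)
    where
    cons-digit : ∀ {n} a → ∃₂ (λ d m → d ∈ D 0 × m ∈ withDigits (D ∘ suc) K × n ≡ toℕ d + m * b) →
                 digit a n ∈ D a
    cons-digit zero    (d , m , d∈ , _   , refl) = subst (_∈ D 0) (sym (digit-head d m)) d∈
    cons-digit (suc a) (d , m , _  , m∈ , refl) =
      subst (_∈ D (suc a)) (sym (digit-tail a d m)) (withDigits-digit (0∈D ∘ suc) K m∈ a)

  withDigits-< : ∀ {D} K {n} → n ∈ withDigits D K → n < b ^ K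
  withDigits-< zero    (here refl) = z<s
  withDigits-< {D} (suc K) n∈ with d , n , _ , n∈′ , refl ← ∈-cartesianProductWith⁻ _ (D 0) (withDigits (D ∘ suc) K) n∈
    = begin-strict
    toℕ d + n * b   <⟨ +-monoˡ-< (n * b) (toℕ<n d) ⟩
    suc n * b       ≤⟨ *-monoˡ-≤ b (withDigits-< K n∈′) ⟩
    b ^ K * b       ≡⟨ *-comm (b ^ K) b ⟩
    b ^ suc K       ∎
    where open ≤-Reasoning

  withDigits-unique : ∀ {D} → (∀ i → Unique (D i)) → ∀ K → Unique (withDigits D K)
  withDigits-unique uniq zero    = All.[] AllPairs.∷ AllPairs.[]
  withDigits-unique uniq (suc K) =
    Unique.cartesianProductWith⁺ _ digit-cons-injective (uniq 0) (withDigits-unique (uniq ∘ suc) K)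

  length-withDigits : ∀ D K → length (withDigits D K) ≡ ∏[ i < K ] length (D i)
  length-withDigits D zero    = refl
  length-withDigits D (suc K) = trans (length-cartesianProductWith _ (D 0) (withDigits (D ∘ suc) K))
                                   (cong (length (D 0) *_) (length-withDigits (D ∘ suc) K))

  Difference : List (Fin b) → ℕ → Set
  Difference S δ = Any (λ d → (toℕ d + δ) mod b ∈ S) S

  Difference-cong : ∀ {S δ ε} → δ % b ≡ ε % b → Difference S δ → Difference S ε
  Difference-cong {S} δ≡ε = Any.map (subst (_∈ S) (mod-cong (+-%-cong refl δ≡ε)))

  Compatible : List (Fin b) → List (Fin b) → Set
  Compatible S T = ∀ δ → b ∤ δ → Difference S δ → Difference T (δ * δ) → ⊥

  CompatibleResidues : List (Fin b) → List (Fin b) → Set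
  CompatibleResidues S T =
    ∀ (r : Fin b) → toℕ r ≢ 0 → Difference S (toℕ r) → Difference T (toℕ r * toℕ r) → ⊥

  compatibleResidues? : ∀ S T → Dec (CompatibleResidues S T)
  compatibleResidues? S T = all? λ r →
    ¬? (toℕ r ≟ 0) →-dec difference? S (toℕ r) →-dec ¬? (difference? T (toℕ r * toℕ r))
    where
    open import Data.List.Membership.DecPropositional (Fin._≟_ {b}) using (_∈?_)
    difference? : ∀ S δ → Dec (Difference S δ)
    difference? S δ = any? (λ d → (toℕ d + δ) mod b ∈? S) S

  residues⇒compatible : ∀ {S T} → CompatibleResidues S T → Compatible S T
  residues⇒compatible compatible δ b∤δ diff diff² =
    compatible (δ mod b) r≢0 (Difference-cong (sym r≡δ) diff) (Difference-cong (sym (*-%-cong r≡δ r≡δ)) diff²)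
    where
    r≡δ : toℕ (δ mod b) % b ≡ δ % b
    r≡δ = trans (cong (_% b) (toℕ-mod δ)) (m%n%n≡m%n δ b)
    r≢0 : toℕ (δ mod b) ≢ 0
    r≢0 r≡0 = b∤δ (m%n≡0⇒n∣m δ b (trans (sym (toℕ-mod δ)) r≡0))

  module _ {D : ℕ → List (Fin b)} (0∈D : ∀ i → 0 mod b ∈ D i) (K : ℕ) where

    shift-difference : ∀ {x y} a u → x ∈ withDigits D K → y ∈ withDigits D K → x + u * b ^ a ≡ y →
                       Difference (D a) u
    shift-difference {x} a u x∈ y∈ refl =
      lose (withDigits-digit 0∈D K x∈ a) (subst (_∈ D a) (digit-shift a x u) (withDigits-digit 0∈D K y∈ a))

    withDigits-configFree : 1 < b → (∀ a → Compatible (D a) (D (a + a))) → ConfigFree (withDigits D K)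
    withDigits-configFree 1<b compatible {x} {y} {z} δ≢0 x∈ y∈ z∈ shift square
      with a , u , refl , b∤u ← factor-power 1<b δ≢0
      = compatible a u b∤u (linear shift)
          (shift-difference (a + a) (u * u) x∈ z∈ (trans (cong (x +_) (sym (square-split u a))) square))
      where
      linear : x + u * b ^ a ≡ y ⊎ y + u * b ^ a ≡ x → Difference (D a) u
      linear (inj₁ x+δ≡y) = shift-difference a u x∈ y∈ x+δ≡y
      linear (inj₂ y+δ≡x) = shift-difference a u y∈ x∈ y+δ≡x
      square-split : ∀ u a → u * b ^ a * (u * b ^ a) ≡ u * u * b ^ (a + a)
      square-split u a = trans (interchange u (b ^ a) u (b ^ a)) (cong (u * u *_) (sym (^-distribˡ-+-* b a a)))

oneBased : List ℕ → List ℤ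
oneBased = map (λ n → ℤ.+ suc n)

oneBased-⊆ : ∀ {S N} → Unique S → All (_< N) S → SubsetOfRange N (oneBased S)
oneBased-⊆ uniq bounded =
  Unique.map⁺ (suc-injective ∘ ℤ.+-injective) uniq ,
  All.map⁺ (All.map (λ n<N → ℤ.+≤+ (s≤s z≤n) , ℤ.+≤+ n<N) bounded)

oneBased-free : ∀ {S} → ConfigFree S → NoNontrivialConfig (oneBased S)
oneBased-free free x y y≢0 x∈ x+y∈ x+y²∈
  with m , m∈ , refl ← ∈-map⁻ _ x∈
     | n , n∈ , x+y≡ ← ∈-map⁻ _ x+y∈
     | p , p∈ , x+y²≡ ← ∈-map⁻ _ x+y²∈
     = by-sign y y≢0 x+y≡ x+y²≡
  where
  by-sign : ∀ y → y ≢ ℤ.+ 0 → ℤ.+ suc m ℤ.+ y ≡ ℤ.+ suc n → ℤ.+ suc m ℤ.+ y ℤ.* y ≡ ℤ.+ suc p → ⊥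
  by-sign (ℤ.+ zero)   y≢0 _   _    = y≢0 refl
  by-sign ℤ.+[1+ j ]   _   x+y x+y² =
    free (λ ()) m∈ n∈ p∈ (inj₁ (suc-injective (ℤ.+-injective x+y))) (suc-injective (ℤ.+-injective x+y²))
  by-sign ℤ.-[1+ j ]   _   x+y x+y² =
    free (λ ()) m∈ n∈ p∈ (inj₂ (suc-injective (ℤ.+-injective (sym y+x)))) (suc-injective (ℤ.+-injective x+y²))
    where
    cancel : ∀ i k → i ≡ i ℤ.- k ℤ.+ k
    cancel = ℤ.solve-∀
    y+x : ℤ.+ suc m ≡ ℤ.+ suc n ℤ.+ ℤ.+ suc j
    y+x = trans (cancel (ℤ.+ suc m) (ℤ.+ suc j)) (cong (ℤ._+ ℤ.+ suc j) x+y)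

open Digits 65

data Kind : Set where
  null full seven seventeen : Kind

digits : Kind → List (Fin 65)
digits null      = # 0 ∷ []
digits full      = allFin 65
digits seven     = # 0 ∷ # 2 ∷ # 5 ∷ # 24 ∷ # 43 ∷ # 46 ∷ # 48 ∷ []
digits seventeen = # 0 ∷ # 1 ∷ # 2 ∷ # 7 ∷ # 12 ∷ # 13 ∷ # 18 ∷ # 23 ∷ # 28 ∷ # 33 ∷ # 34 ∷ # 39 ∷ # 44 ∷ # 45 ∷ # 50 ∷ # 55 ∷ # 60 ∷ []

size : Kind → ℕ
size = length ∘ digits

0∈digits : ∀ k → 0 mod 65 ∈ digits k
0∈digits null      = here refl
0∈digits full      = here refl
0∈digits seven     = here refl
0∈digits seventeen = here refl

digits-unique : ∀ k → Unique (digits k)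
digits-unique null      = from-yes (unique? Fin._≟_ (digits null))
digits-unique full      = from-yes (unique? Fin._≟_ (digits full))
digits-unique seven     = from-yes (unique? Fin._≟_ (digits seven))
digits-unique seventeen = from-yes (unique? Fin._≟_ (digits seventeen))

promote : Kind → Kind
promote null      = null
promote full      = seven
promote seven     = seventeen
promote seventeen = seven

promote⁴≡promote² : ∀ k → promote (promote (promote (promote k))) ≡ promote (promote k)
promote⁴≡promote² null      = refl
promote⁴≡promote² full      = refl
promote⁴≡promote² seven     = refl
promote⁴≡promote² seventeen = refl

compatible-promote : ∀ k → Compatible (digits k) (digits (promote k))
compatible-promote null      = residues⇒compatible (from-yes (compatibleResidues? (digits null) (digits null)))
compatible-promote full      = residues⇒compatible (from-yes (compatibleResidues? (digits full) (digits seven)))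
compatible-promote seven     = residues⇒compatible (from-yes (compatibleResidues? (digits seven) (digits seventeen)))
compatible-promote seventeen = residues⇒compatible (from-yes (compatibleResidues? (digits seventeen) (digits seven)))

compatible-null : ∀ k → Compatible (digits k) (digits null)
compatible-null null      = residues⇒compatible (from-yes (compatibleResidues? (digits null) (digits null)))
compatible-null full      = residues⇒compatible (from-yes (compatibleResidues? (digits full) (digits null)))
compatible-null seven     = residues⇒compatible (from-yes (compatibleResidues? (digits seven) (digits null)))
compatible-null seventeen = residues⇒compatible (from-yes (compatibleResidues? (digits seventeen) (digits null)))

parity[n+n+t]≡parity[t] : ∀ n t → parity (n + n + t) ≡ parity t
parity[n+n+t]≡parity[t] zero    t = refl
parity[n+n+t]≡parity[t] (suc n) t rewrite +-suc n n = parity[n+n+t]≡parity[t] n t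

⌊n+n+t/2⌋≡n+⌊t/2⌋ : ∀ n t → ⌊ n + n + t /2⌋ ≡ n + ⌊ t /2⌋
⌊n+n+t/2⌋≡n+⌊t/2⌋ zero    t = refl
⌊n+n+t/2⌋≡n+⌊t/2⌋ (suc n) t rewrite +-suc n n = cong suc (⌊n+n+t/2⌋≡n+⌊t/2⌋ n t)

byParity : Parity → Kind → Kind
byParity 0ℙ k = promote k
byParity 1ℙ k = full

-- With v the 2-adic valuation of t mod 2^M: kind M t is full for v = 0, then alternately
-- seven and seventeen as v grows, and null when 2^M ∣ t.
kind : ℕ → ℕ → Kind
kind zero    t = null
kind (suc M) t = byParity (parity t) (kind M ⌊ t /2⌋)

kind-double : ∀ M t → kind (suc M) (t + t) ≡ promote (kind M t)
kind-double M t = cong₂ byParity parity-even (cong (kind M) (sym (n≡⌊n+n/2⌋ t)))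
  where
  parity-even : parity (t + t) ≡ 0ℙ
  parity-even = trans (cong parity (sym (+-identityʳ (t + t)))) (parity[n+n+t]≡parity[t] t 0)

kind-odd : ∀ M t → kind (suc M) (suc (t + t)) ≡ full
kind-odd M t = cong (λ p → byParity p (kind M ⌊ suc (t + t) /2⌋)) parity-odd
  where
  parity-odd : parity (suc (t + t)) ≡ 1ℙ
  parity-odd = trans (cong parity (+-comm 1 (t + t))) (parity[n+n+t]≡parity[t] t 1)

kind-suc : ∀ M t → kind (suc M) t ≡ kind M t ⊎ kind M t ≡ null
kind-suc zero    t = inj₂ refl
kind-suc (suc M) t with parity t | kind-suc M ⌊ t /2⌋
... | 1ℙ | _            = inj₁ refl
... | 0ℙ | inj₁ same    = inj₁ (cong promote same)
... | 0ℙ | inj₂ isNull  = inj₂ (cong promote isNull)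

kind-periodic : ∀ M t → kind M (2 ^ M + t) ≡ kind M t
kind-periodic zero    t = refl
kind-periodic (suc M) t
  rewrite +-identityʳ (2 ^ M) | parity[n+n+t]≡parity[t] (2 ^ M) t | ⌊n+n+t/2⌋≡n+⌊t/2⌋ (2 ^ M) t
        | kind-periodic M ⌊ t /2⌋ = refl

kind-compatible : ∀ M a → Compatible (digits (kind M a)) (digits (kind M (a + a)))
kind-compatible zero    a = compatible-null null
kind-compatible (suc M) a rewrite kind-double M a with kind-suc M a
... | inj₁ same   rewrite same   = compatible-promote (kind M a)
... | inj₂ isNull rewrite isNull = compatible-null (kind (suc M) a)

kindProduct : ℕ → (Kind → ℕ) → ℕ
kindProduct M g = ∏[ i < 2 ^ M ] g (kind M i)

kindProduct-suc : ∀ M g → kindProduct (suc M) g ≡ g full ^ 2 ^ M * kindProduct M (g ∘ promote)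
kindProduct-suc M g = begin
  ∏< (2 ^ M + (2 ^ M + 0)) f                           ≡⟨ cong (λ n → ∏< (2 ^ M + n) f) (+-identityʳ (2 ^ M)) ⟩
  ∏< (2 ^ M + 2 ^ M) f                                 ≡⟨ ∏-interleave (2 ^ M) f ⟩
  ∏[ i < 2 ^ M ] (f (i + i) * f (suc (i + i)))         ≡⟨ ∏-* (2 ^ M) _ _ ⟩
  ∏[ i < 2 ^ M ] f (i + i) * ∏[ i < 2 ^ M ] f (suc (i + i))
    ≡⟨ cong₂ _*_ (∏-cong (2 ^ M) (cong g ∘ kind-double M)) (∏-cong (2 ^ M) (cong g ∘ kind-odd M)) ⟩
  kindProduct M (g ∘ promote) * ∏[ i < 2 ^ M ] g full  ≡⟨ cong (kindProduct M (g ∘ promote) *_) (∏-const (2 ^ M) (g full)) ⟩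
  kindProduct M (g ∘ promote) * g full ^ 2 ^ M         ≡⟨ *-comm (kindProduct M (g ∘ promote)) _ ⟩
  g full ^ 2 ^ M * kindProduct M (g ∘ promote)         ∎
  where
  open ≡-Reasoning
  f = g ∘ kind (suc M)

^-2^-suc : ∀ x M → x ^ 2 ^ suc M ≡ (x ^ 2 ^ M) ^ 2
^-2^-suc x M = trans (cong (x ^_) (*-comm 2 (2 ^ M))) (sym (^-*-assoc x (2 ^ M) 2))

^-4^-suc : ∀ x m → x ^ 2 ^ (suc m + suc m) ≡ (x ^ 2 ^ (m + m)) ^ 4
^-4^-suc x m = begin
  x ^ 2 ^ suc (m + suc m)       ≡⟨ cong (λ k → x ^ 2 ^ suc k) (+-suc m m) ⟩
  x ^ (2 * (2 * 2 ^ (m + m)))   ≡⟨ cong (x ^_) (quadruple (2 ^ (m + m))) ⟩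
  x ^ (2 ^ (m + m) * 4)         ≡⟨ ^-*-assoc x (2 ^ (m + m)) 4 ⟨
  (x ^ 2 ^ (m + m)) ^ 4         ∎
  where
  open ≡-Reasoning
  quadruple : ∀ l → 2 * (2 * l) ≡ l * 4
  quadruple = solve-∀

kindProduct-suc² : ∀ M g → kindProduct (suc (suc M)) g ≡
  (g full ^ 2 ^ M) ^ 2 * (g (promote full) ^ 2 ^ M * kindProduct M (g ∘ promote ∘ promote))
kindProduct-suc² M g = trans (kindProduct-suc (suc M) g)
                             (cong₂ _*_ (^-2^-suc (g full) M) (kindProduct-suc M (g ∘ promote)))

blockSize : ℕ → ℕ
blockSize M = kindProduct M size

evenProduct : ℕ → ℕ
evenProduct m = kindProduct (m + m) (size ∘ promote ∘ promote)

evenProduct-suc : ∀ m → evenProduct (suc m) ≡ (17 ^ 2 ^ (m + m)) ^ 2 * (7 ^ 2 ^ (m + m) * evenProduct m)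
evenProduct-suc m = begin
  kindProduct (suc (m + suc m)) h   ≡⟨ cong (λ k → kindProduct (suc k) h) (+-suc m m) ⟩
  kindProduct (suc (suc (m + m))) h ≡⟨ kindProduct-suc² (m + m) h ⟩
  (17 ^ L) ^ 2 * (7 ^ L * kindProduct (m + m) (h ∘ promote ∘ promote))
    ≡⟨ cong (λ e → (17 ^ L) ^ 2 * (7 ^ L * e)) (∏-cong L (cong size ∘ promote⁴≡promote² ∘ kind (m + m))) ⟩
  (17 ^ L) ^ 2 * (7 ^ L * evenProduct m) ∎
  where
  open ≡-Reasoning
  h = size ∘ promote ∘ promote
  L = 2 ^ (m + m)

evenProduct-closed : ∀ m → evenProduct m ^ 3 * 2023 ≡ 7 ^ 2 ^ (m + m) * (17 ^ 2 ^ (m + m)) ^ 2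
evenProduct-closed zero    = refl
evenProduct-closed (suc m) = begin
  evenProduct (suc m) ^ 3 * 2023              ≡⟨ cong (λ e → e ^ 3 * 2023) (evenProduct-suc m) ⟩
  ((T ^ 2) * (S * E)) ^ 3 * 2023              ≡⟨ regroup T S E ⟩
  T ^ 6 * S ^ 3 * (E ^ 3 * 2023)              ≡⟨ cong (T ^ 6 * S ^ 3 *_) (evenProduct-closed m) ⟩
  T ^ 6 * S ^ 3 * (S * T ^ 2)                 ≡⟨ collect T S ⟩
  S ^ 4 * (T ^ 4) ^ 2                         ≡⟨ cong₂ (λ s t → s * t ^ 2) (^-4^-suc 7 m) (^-4^-suc 17 m) ⟨
  7 ^ 2 ^ (suc m + suc m) * (17 ^ 2 ^ (suc m + suc m)) ^ 2 ∎
  where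
  open ≡-Reasoning
  S = 7 ^ 2 ^ (m + m)
  T = 17 ^ 2 ^ (m + m)
  E = evenProduct m
  regroup : ∀ t s x → (t ^ 2 * (s * x)) ^ 3 * 2023 ≡ t ^ 6 * s ^ 3 * (x ^ 3 * 2023)
  regroup = solve 3 (λ t s x → (t :^ 2 :* (s :* x)) :^ 3 :* con 2023 := t :^ 6 :* s :^ 3 :* (x :^ 3 :* con 2023)) refl
  collect : ∀ t s → t ^ 6 * s ^ 3 * (s * t ^ 2) ≡ s ^ 4 * (t ^ 4) ^ 2
  collect = solve 2 (λ t s → t :^ 6 :* s :^ 3 :* (s :* t :^ 2) := s :^ 4 :* (t :^ 4) :^ 2) refl

-- So blockSize M is 65^(γ·2^M) up to the factor 2023^(-1/3), where γ = log₆₅(65³·833)/6.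
blockSize-closed : ∀ m → blockSize (suc m + suc m) ^ 6 * 2023 ^ 2 ≡ (833 * 65 ^ 3) ^ 2 ^ (suc m + suc m)
blockSize-closed m = begin
  blockSize (suc m + suc m) ^ 6 * 2023 ^ 2          ≡⟨ cong (λ k → kindProduct (suc k) size ^ 6 * 2023 ^ 2) (+-suc m m) ⟩
  kindProduct (suc (suc (m + m))) size ^ 6 * 2023 ^ 2 ≡⟨ cong (λ e → e ^ 6 * 2023 ^ 2) (kindProduct-suc² (m + m) size) ⟩
  (A ^ 2 * (S * E)) ^ 6 * 2023 ^ 2                  ≡⟨ regroup A S E ⟩
  A ^ 12 * S ^ 6 * (E ^ 3 * 2023) ^ 2               ≡⟨ cong (λ e → A ^ 12 * S ^ 6 * e ^ 2) (evenProduct-closed m) ⟩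
  A ^ 12 * S ^ 6 * (S * T ^ 2) ^ 2                  ≡⟨ collect A S T ⟩
  ((S ^ 2 * T) * A ^ 3) ^ 4                         ≡⟨ cong (λ y → y ^ 4) (cong₂ _*_ 833^L (^-comm 65 L 3)) ⟩
  (833 ^ L * (65 ^ 3) ^ L) ^ 4                      ≡⟨ cong (_^ 4) (^-distrib-* 833 (65 ^ 3) L) ⟨
  ((833 * 65 ^ 3) ^ L) ^ 4                          ≡⟨ ^-4^-suc (833 * 65 ^ 3) m ⟨
  (833 * 65 ^ 3) ^ 2 ^ (suc m + suc m)              ∎
  where
  open ≡-Reasoning
  L = 2 ^ (m + m)
  A = 65 ^ L
  S = 7 ^ L
  T = 17 ^ L
  E = evenProduct m
  833^L : S ^ 2 * T ≡ 833 ^ L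
  833^L = trans (cong (_* T) (^-comm 7 L 2)) (sym (^-distrib-* (7 ^ 2) 17 L))
  regroup : ∀ a s x → (a ^ 2 * (s * x)) ^ 6 * 2023 ^ 2 ≡ a ^ 12 * s ^ 6 * (x ^ 3 * 2023) ^ 2
  regroup = solve 3 (λ a s x → (a :^ 2 :* (s :* x)) :^ 6 :* con 2023 :^ 2 := a :^ 12 :* s :^ 6 :* (x :^ 3 :* con 2023) :^ 2) refl
  collect : ∀ a s t → a ^ 12 * s ^ 6 * (s * t ^ 2) ^ 2 ≡ ((s ^ 2 * t) * a ^ 3) ^ 4
  collect = solve 3 (λ a s t → a :^ 12 :* s :^ 6 :* (s :* t :^ 2) :^ 2 := ((s :^ 2 :* t) :* a :^ 3) :^ 4) refl

-- The hypothesis is X < 833^B·65^(3B) for X = 65^(6a); once 2^M ≥ X·C, Bernoulli's inequality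
-- and blockSize-closed give X^(2^M)·C ≤ (blockSize M ^ B)^6·C.
dense-block : ∀ a b → RatBelowGamma a (suc b) → Σ ℕ λ M → (65 ^ 2 ^ M) ^ a ≤ blockSize M ^ suc b
dense-block a b a/B<γ = M , ^-cancelʳ-≤ 6 (*-cancelʳ-≤ _ _ C (begin
  ((65 ^ P) ^ a) ^ 6 * C          ≡⟨ cong (_* C) Xᴾ ⟨
  X ^ P * C                       ≤⟨ x^P*c≤y^P C P a/B<γ (<⇒≤ XC<P) ⟩
  (833 ^ B * 65 ^ (3 * B)) ^ P    ≡⟨ Yᴾ ⟩
  (blockSize M ^ B) ^ 6 * C       ∎))
  where
  open ≤-Reasoning
  B = suc b
  X = 65 ^ (6 * a)
  C = (2023 ^ 2) ^ B
  m = X * C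
  M = suc m + suc m
  P = 2 ^ M
  instance
    X≢0 : NonZero X
    X≢0 = m^n≢0 65 (6 * a)
    C≢0 : NonZero C
    C≢0 = m^n≢0 (2023 ^ 2) B
  XC<P : X * C < P
  XC<P = <-≤-trans (n<2^n m) (^-monoʳ-≤ 2 (≤-trans (n≤1+n m) (m≤m+n (suc m) (suc m))))
  Xᴾ : X ^ P ≡ ((65 ^ P) ^ a) ^ 6
  Xᴾ = begin-equality
    (65 ^ (6 * a)) ^ P   ≡⟨ cong (_^ P) (^-*-assoc 65 6 a) ⟨
    ((65 ^ 6) ^ a) ^ P   ≡⟨ ^-comm (65 ^ 6) a P ⟩
    ((65 ^ 6) ^ P) ^ a   ≡⟨ cong (_^ a) (^-comm 65 6 P) ⟩
    ((65 ^ P) ^ 6) ^ a   ≡⟨ ^-comm (65 ^ P) 6 a ⟩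
    ((65 ^ P) ^ a) ^ 6   ∎
  Yᴾ : (833 ^ B * 65 ^ (3 * B)) ^ P ≡ (blockSize M ^ B) ^ 6 * C
  Yᴾ = begin-equality
    (833 ^ B * 65 ^ (3 * B)) ^ P              ≡⟨ cong (λ y → (833 ^ B * y) ^ P) (^-*-assoc 65 3 B) ⟨
    (833 ^ B * (65 ^ 3) ^ B) ^ P              ≡⟨ cong (_^ P) (^-distrib-* 833 (65 ^ 3) B) ⟨
    ((833 * 65 ^ 3) ^ B) ^ P                  ≡⟨ ^-comm (833 * 65 ^ 3) B P ⟩
    ((833 * 65 ^ 3) ^ P) ^ B                  ≡⟨ cong (_^ B) (blockSize-closed m) ⟨
    (blockSize M ^ 6 * 2023 ^ 2) ^ B          ≡⟨ ^-distrib-* (blockSize M ^ 6) (2023 ^ 2) B ⟩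
    (blockSize M ^ 6) ^ B * C                 ≡⟨ cong (_* C) (^-comm (blockSize M) 6 B) ⟩
    (blockSize M ^ B) ^ 6 * C                 ∎

digitSet : ℕ → ℕ → List ℤ
digitSet M k = oneBased (withDigits (digits ∘ kind M) (k * 2 ^ M))

digitSet-⊆ : ∀ M k {N} → (65 ^ 2 ^ M) ^ k ≤ N → SubsetOfRange N (digitSet M k)
digitSet-⊆ M k {N} bound = oneBased-⊆ (withDigits-unique (digits-unique ∘ kind M) (k * 2 ^ M))
  (All.tabulate λ n∈ → <-≤-trans (withDigits-< (k * 2 ^ M) n∈) (subst (_≤ N) 65^[P*k] bound))
  where
  65^[P*k] : (65 ^ 2 ^ M) ^ k ≡ 65 ^ (k * 2 ^ M)
  65^[P*k] = trans (^-*-assoc 65 (2 ^ M) k) (cong (65 ^_) (*-comm (2 ^ M) k))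

digitSet-free : ∀ M k → NoNontrivialConfig (digitSet M k)
digitSet-free M k =
  oneBased-free (withDigits-configFree (0∈digits ∘ kind M) (k * 2 ^ M) (s≤s (s≤s z≤n)) (kind-compatible M))

length-digitSet : ∀ M k → length (digitSet M k) ≡ blockSize M ^ k
length-digitSet M k = begin
  length (oneBased (withDigits D (k * 2 ^ M)))  ≡⟨ length-map _ (withDigits D (k * 2 ^ M)) ⟩
  length (withDigits D (k * 2 ^ M))             ≡⟨ length-withDigits D (k * 2 ^ M) ⟩
  ∏[ i < k * 2 ^ M ] size (kind M i)            ≡⟨ ∏-periodic (2 ^ M) k _ (cong size ∘ kind-periodic M) ⟩
  blockSize M ^ k                               ∎
  where
  open ≡-Reasoning
  D = digits ∘ kind M

digitSet-large : ∀ a b {N} M k → (65 ^ 2 ^ M) ^ a ≤ blockSize M ^ suc b → suc N ≤ (65 ^ 2 ^ M) ^ suc k →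
                 suc N ^ a ≤ suc ((65 ^ 2 ^ M) ^ a) ^ suc b * length (digitSet M k) ^ suc b
digitSet-large a b {N} M k dense N<Bᵏ⁺¹ =
  subst (λ ℓ → suc N ^ a ≤ suc ((65 ^ 2 ^ M) ^ a) ^ suc b * ℓ ^ suc b)
        (sym (length-digitSet M k)) (growth-bound {a = a} {b = b} k dense N<Bᵏ⁺¹)

theorem1p1 : (a b : ℕ) → RatBelowGamma a (suc b) →
    Σ ℕ λ q → (N : ℕ) → Σ (List ℤ) λ A →
      SubsetOfRange (suc N) A × NoNontrivialConfig A ×
      (suc N) ^ a ≤ (suc q) ^ (suc b) * length A ^ (suc b)
theorem1p1 a b a/B<γ =
  let M , dense = dense-block a b a/B<γ in
  (65 ^ 2 ^ M) ^ a , λ N →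
    let k , lo , hi = between-powers (1<65^2^M M) N in
    digitSet M k , digitSet-⊆ M k lo , digitSet-free M k , digitSet-large a b M k dense (<⇒≤ hi)
  where
  1<65^2^M : ∀ M → 1 < 65 ^ 2 ^ M
  1<65^2^M M = <-≤-trans (s≤s (s≤s z≤n)) (^-monoʳ-≤ 65 (m^n>0 2 M))
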